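{- Suppose $f$ is computed by a monotone algebraic circuit with projection gates of size $s$. Then for every $k\le\deg(f)$, the homogeneous component $\hom_k(f)$ has a monotone algebraic circuit with projection gates of size $O(k^2\cdot s)$.
   Context: Work over $\mathbb{R}$ (or $\mathbb{Q}$). A projection gate is a unary gate labelled by a variable $z$ and $b\in\{0,1\}$, returning $f(b,\mathbf{x})$ on input $f(z,\mathbf{x})$. A monotone algebraic circuit with projection gates is a directed acyclic graph whose leaves are labelled by variables or non-negative constants and whose internal nodes are addition or multiplication gates of in-degree 2 or projection gates; a subset of the variables is marked auxiliary, only auxiliary variables label projection gates, and auxiliary variables do not appear in the output polynomial; size is the number of nodes. Degrees are taken in the non-auxiliary variables $\mathbf{x}$, and $\hom_k(f)$ denotes the homogeneous degree-$k$ component of $f$ in $\mathbf{x}$. -}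

module Defs where

open import Data.Nat using (ℕ; zero; suc; _≤_)
open import Data.Bool using (Bool; true; false)
open import Data.Fin using (Fin)
open import Data.Vec using (Vec; lookup; _[_]≔_; replicate; _∷_; [])
import Data.Vec.Properties as VP
open import Data.List using (List; []; _∷_; _++_; filter; map; concatMap)
open import Data.Product using (_×_; _,_; ∃-syntax)
import Data.Product.Properties as PP
open import Data.Rational as Q using (ℚ; 0ℚ)
open import Relation.Nullary using (Dec; yes; no; ¬_)
open import Relation.Binary.PropositionalEquality using (_≡_)
import Data.Nat.Properties as NP
open import Data.Sum using (_⊎_)

-- Polynomials over ℚ in n non-auxiliary variables x and a auxiliary
-- variables z, represented as formal (unnormalised) sums of terms.
-- Two polynomials are equal iff they have the same coefficients.

Mono : ℕ → ℕ → Set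
Mono n a = Vec ℕ n × Vec ℕ a

Poly : ℕ → ℕ → Set
Poly n a = List (ℚ × Mono n a)

∣_∣ : ∀ {n} → Vec ℕ n → ℕ
∣ [] ∣ = 0
∣ e ∷ es ∣ = e Data.Nat.+ ∣ es ∣

module _ {n a : ℕ} where

  monoEq? : (m m' : Mono n a) → Dec (m ≡ m')
  monoEq? = PP.≡-dec (VP.≡-dec NP._≟_) (VP.≡-dec NP._≟_)

  coeff : Poly n a → Mono n a → ℚ
  coeff [] m = 0ℚ
  coeff ((q , m') ∷ p) m with monoEq? m' m
  ... | yes _ = q Q.+ coeff p m
  ... | no  _ = coeff p m

  addP : Poly n a → Poly n a → Poly n a
  addP p q = p ++ q

  mulP : Poly n a → Poly n a → Poly n a
  mulP p q = concatMap (λ { (c , (x , z)) →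
               map (λ { (d , (x' , z')) →
                   (c Q.* d , (Data.Vec.zipWith Data.Nat._+_ x x'
                              , Data.Vec.zipWith Data.Nat._+_ z z')) }) q }) p

  -- projection gate: f(z, x) ↦ f(b, x) for the auxiliary variable z and b ∈ {0,1}
  projP : Fin a → Bool → Poly n a → Poly n a
  projP i false p = filter (λ { (c , (x , z)) → lookup z i NP.≟ 0 }) p
  projP i true  p = map (λ { (c , (x , z)) → (c , (x , z [ i ]≔ 0)) }) p

  varX : Fin n → Poly n a
  varX i = (Q.1ℚ , (replicate n 0 [ i ]≔ 1 , replicate a 0)) ∷ []

  varZ : Fin a → Poly n a
  varZ i = (Q.1ℚ , (replicate n 0 , replicate a 0 [ i ]≔ 1)) ∷ []

  constP : ℚ → Poly n a
  constP c = (c , (replicate n 0 , replicate a 0)) ∷ []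

  NoAux : Poly n a → Set
  NoAux p = ∀ x z → ¬ (coeff p (x , z) ≡ 0ℚ) → z ≡ replicate a 0

  coeffX : Poly n a → Vec ℕ n → ℚ
  coeffX p x = coeff p (x , replicate a 0)

  hom : ℕ → Poly n a → Poly n a
  hom k = filter (λ { (c , (x , z)) → ∣ x ∣ NP.≟ k })

  -- k ≤ deg f  (degree in x; convention deg 0 = 0)
  ≤deg : ℕ → Poly n a → Set
  ≤deg k p = k ≡ 0 ⊎ ∃[ x ] ∃[ z ] (¬ (coeff p (x , z) ≡ 0ℚ) × k ≤ ∣ x ∣)

_≈ₓ_ : ∀ {n a a'} → Poly n a → Poly n a' → Set
p ≈ₓ q = ∀ x → coeffX p x ≡ coeffX q x

-- Monotone algebraic circuits with projection gates, as straight-line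
-- programs (topologically ordered DAGs). A gate at position i may only
-- refer to the i gates before it. Size = number of gates (nodes).

data Gate (n a i : ℕ) : Set where
  xLeaf : Fin n → Gate n a i
  zLeaf : Fin a → Gate n a i
  cLeaf : (c : ℚ) → 0ℚ Q.≤ c → Gate n a i
  add   : Fin i → Fin i → Gate n a i
  mul   : Fin i → Fin i → Gate n a i
  proj  : Fin a → Bool → Fin i → Gate n a i

data Circuit (n a : ℕ) : ℕ → Set where
  []  : Circuit n a 0
  _▷_ : ∀ {i} → Circuit n a i → Gate n a i → Circuit n a (suc i)

evalAll : ∀ {n a i} → Circuit n a i → Vec (Poly n a) i
evalAll [] = []
evalAll {n} {a} {suc i} (Φ ▷ g) = vs Data.Vec.∷ʳ evalGate g
  where
  vs = evalAll Φ
  evalGate : Gate n a i → Poly n a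
  evalGate (xLeaf j)   = varX j
  evalGate (zLeaf j)   = varZ j
  evalGate (cLeaf c _) = constP c
  evalGate (add j k)   = addP (lookup vs j) (lookup vs k)
  evalGate (mul j k)   = mulP (lookup vs j) (lookup vs k)
  evalGate (proj z b j) = projP z b (lookup vs j)

output : ∀ {n a s} → Circuit n a (suc s) → Poly n a
output Φ = Data.Vec.last (evalAll Φ)

-- Every gate g of the circuit is replaced by gates computing hom 0 g, …, hom k g.
-- Taking homogeneous parts commutes with sums and with projections (substituting an
-- auxiliary variable leaves the x-degree unchanged), hom j of a leaf is the leaf or 0,
-- and for products  hom j (g · h) = Σ_{i ≤ j} hom i g · hom (j − i) h,  which costs
-- 2j + 1 gates. Each original gate therefore costs at most 2(k + 1)² new gates.
-- Polynomials are formal sums here, so identities between them are proved by pairing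
-- with arbitrary weights on monomials, ⟨G , p⟩ = Σ c · G(m); an indicator weight
-- recovers a coefficient.
module Submission where

open import Defs
import Algebra.Properties.CommutativeSemigroup as CommutativeSemigroupProperties
open import Algebra.Bundles using (CommutativeMonoid)
open import Data.Bool using (Bool; true; false)
open import Data.Empty using (⊥-elim)
open import Data.Fin using (Fin; fromℕ; inject₁)
open import Data.Fin.Relation.Unary.Top using (view; ‵fromℕ; ‵inject₁)
open import Data.List using ([]; _∷_; _++_; filter; map)
import Data.List.Properties as ListP
open import Data.Nat as ℕ using (ℕ; zero; suc; _≤_; _<_; _∸_; _≟_; _≤?_; z≤n; s≤s; s≤s⁻¹)
import Data.Nat.Properties as NP
open import Data.Nat.Tactic.RingSolver using (solve-∀)
open import Data.Product using (Σ; _×_; _,_; proj₁; ∃-syntax)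
open import Data.Rational as ℚ using (ℚ; 0ℚ; 1ℚ)
import Data.Rational.Properties as ℚP
open import Data.Vec using (Vec; []; _∷_; lookup; _∷ʳ_; zipWith; replicate; _[_]≔_)
import Data.Vec.Properties as VecP
open import Function using (_$_)
open import Relation.Binary.PropositionalEquality
open import Relation.Nullary using (Dec; yes; no; ¬_; does)

∣zipWith-+∣ : ∀ {n} (x y : Vec ℕ n) → ∣ zipWith ℕ._+_ x y ∣ ≡ ∣ x ∣ ℕ.+ ∣ y ∣
∣zipWith-+∣ [] [] = refl
∣zipWith-+∣ (u ∷ x) (v ∷ y) =
  trans (cong (u ℕ.+ v ℕ.+_) (∣zipWith-+∣ x y)) (interchange u v ∣ x ∣ ∣ y ∣)
  where open CommutativeSemigroupProperties NP.+-commutativeSemigroup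

filter-comm : ∀ {a p q} {A : Set a} {P : A → Set p} {Q : A → Set q}
              (P? : ∀ x → Dec (P x)) (Q? : ∀ x → Dec (Q x)) xs →
              filter P? (filter Q? xs) ≡ filter Q? (filter P? xs)
filter-comm P? Q? []       = refl
filter-comm P? Q? (x ∷ xs) with does (P? x) in p | does (Q? x) in q
... | true  | true  rewrite p | q = cong (x ∷_) (filter-comm P? Q? xs)
... | true  | false rewrite q = filter-comm P? Q? xs
... | false | true  rewrite p = filter-comm P? Q? xs
... | false | false = filter-comm P? Q? xs

onlyIf : ∀ {ℓ} {A : Set ℓ} → Dec A → ℚ → ℚ
onlyIf (yes _) q = q
onlyIf (no _)  _ = 0ℚ

module _ {ℓ} {A : Set ℓ} where

  onlyIf-yes : (d : Dec A) → A → ∀ q → onlyIf d q ≡ q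
  onlyIf-yes (yes _) _ _ = refl
  onlyIf-yes (no ¬a) a _ = ⊥-elim (¬a a)

  onlyIf-no : (d : Dec A) → ¬ A → ∀ q → onlyIf d q ≡ 0ℚ
  onlyIf-no (yes a) ¬a _ = ⊥-elim (¬a a)
  onlyIf-no (no _)  _  _ = refl

  onlyIf-0ℚ : (d : Dec A) → onlyIf d 0ℚ ≡ 0ℚ
  onlyIf-0ℚ (yes _) = refl
  onlyIf-0ℚ (no _)  = refl

  onlyIf-*ʳ : (d : Dec A) → ∀ c q → onlyIf d (c ℚ.* q) ≡ c ℚ.* onlyIf d q
  onlyIf-*ʳ (yes _) c q = refl
  onlyIf-*ʳ (no _)  c q = sym (ℚP.*-zeroʳ c)

  onlyIf-⇔ : ∀ {ℓ′} {B : Set ℓ′} (d : Dec A) (e : Dec B) → (A → B) → (B → A) → ∀ q → onlyIf d q ≡ onlyIf e q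
  onlyIf-⇔ d (yes b) _ g q = onlyIf-yes d (g b) q
  onlyIf-⇔ d (no ¬b) f _ q = onlyIf-no d (λ a → ¬b (f a)) q

onlyIf-≤?-zero : ∀ d (x : ℕ → ℚ) → onlyIf (d ≟ 0) (x 0) ≡ onlyIf (d ≤? 0) (x d)
onlyIf-≤?-zero zero    x = refl
onlyIf-≤?-zero (suc d) x = refl

onlyIf-≤?-suc : ∀ d i (x : ℕ → ℚ) →
  onlyIf (d ≤? i) (x d) ℚ.+ onlyIf (d ≟ suc i) (x (suc i)) ≡ onlyIf (d ≤? suc i) (x d)
onlyIf-≤?-suc d i x with d ≟ suc i
... | yes refl = begin
  onlyIf (suc i ≤? i) (x (suc i)) ℚ.+ x (suc i) ≡⟨ cong (ℚ._+ x (suc i)) (onlyIf-no (suc i ≤? i) (NP.n≮n i) _) ⟩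
  0ℚ ℚ.+ x (suc i)                               ≡⟨ ℚP.+-identityˡ _ ⟩
  x (suc i)                                      ≡⟨ onlyIf-yes (suc i ≤? suc i) NP.≤-refl _ ⟨
  onlyIf (suc i ≤? suc i) (x (suc i))            ∎
  where open ≡-Reasoning
... | no d≢1+i = trans (ℚP.+-identityʳ _) (onlyIf-⇔ (d ≤? i) (d ≤? suc i) NP.m≤n⇒m≤1+n
        (λ d≤1+i → s≤s⁻¹ (NP.≤∧≢⇒< d≤1+i d≢1+i)) _)

-- Pairing polynomials with weights on monomials

module _ {n a : ℕ} where

  open import Data.Rational using (_+_; _*_)

  deg : Mono n a → ℕ
  deg m = ∣ proj₁ m ∣

  _⊕_ : Mono n a → Mono n a → Mono n a
  (x , z) ⊕ (x′ , z′) = zipWith ℕ._+_ x x′ , zipWith ℕ._+_ z z′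

  deg-⊕ : ∀ m m′ → deg (m ⊕ m′) ≡ deg m ℕ.+ deg m′
  deg-⊕ (x , _) (x′ , _) = ∣zipWith-+∣ x x′

  sumOver : (ℚ × Mono n a → ℚ) → Poly n a → ℚ
  sumOver h []      = 0ℚ
  sumOver h (t ∷ p) = h t + sumOver h p

  sumOver-cong : ∀ {h h′} → (∀ t → h t ≡ h′ t) → ∀ p → sumOver h p ≡ sumOver h′ p
  sumOver-cong h≗h′ []      = refl
  sumOver-cong h≗h′ (t ∷ p) = cong₂ _+_ (h≗h′ t) (sumOver-cong h≗h′ p)

  sumOver-++ : ∀ h p q → sumOver h (p ++ q) ≡ sumOver h p + sumOver h q
  sumOver-++ h []      q = sym (ℚP.+-identityˡ _)
  sumOver-++ h (t ∷ p) q =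
    trans (cong (h t +_) (sumOver-++ h p q)) (sym (ℚP.+-assoc (h t) _ _))

  sumOver-map : ∀ h f p → sumOver h (map f p) ≡ sumOver (λ t → h (f t)) p
  sumOver-map h f []      = refl
  sumOver-map h f (t ∷ p) = cong (h (f t) +_) (sumOver-map h f p)

  sumOver-filter : ∀ {ℓ} {P : ℚ × Mono n a → Set ℓ} (P? : ∀ t → Dec (P t)) h p →
                   sumOver h (filter P? p) ≡ sumOver (λ t → onlyIf (P? t) (h t)) p
  sumOver-filter P? h []      = refl
  sumOver-filter P? h (t ∷ p) with P? t
  ... | yes _ = cong (h t +_) (sumOver-filter P? h p)
  ... | no  _ = trans (sumOver-filter P? h p) (sym (ℚP.+-identityˡ _))

  sumOver-*ˡ : ∀ c h p → sumOver (λ t → c * h t) p ≡ c * sumOver h p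
  sumOver-*ˡ c h []      = sym (ℚP.*-zeroʳ c)
  sumOver-*ˡ c h (t ∷ p) =
    trans (cong (c * h t +_) (sumOver-*ˡ c h p)) (sym (ℚP.*-distribˡ-+ c _ _))

  pair : (Mono n a → ℚ) → Poly n a → ℚ
  pair G = sumOver (λ (c , m) → c * G m)

  pair-cong : ∀ {G H} → (∀ m → G m ≡ H m) → ∀ p → pair G p ≡ pair H p
  pair-cong G≗H = sumOver-cong (λ (c , m) → cong (c *_) (G≗H m))

  pair-++ : ∀ G p q → pair G (p ++ q) ≡ pair G p + pair G q
  pair-++ G = sumOver-++ _

  pair-zero : ∀ p → pair (λ _ → 0ℚ) p ≡ 0ℚ
  pair-zero []            = refl
  pair-zero ((c , _) ∷ p) = trans (cong₂ _+_ (ℚP.*-zeroʳ c) (pair-zero p)) (ℚP.+-identityˡ 0ℚ)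

  pair-+ : ∀ G H p → pair (λ m → G m + H m) p ≡ pair G p + pair H p
  pair-+ G H []            = sym (ℚP.+-identityˡ 0ℚ)
  pair-+ G H ((c , m) ∷ p) = begin
    c * (G m + H m) + pair (λ m → G m + H m) p  ≡⟨ cong₂ _+_ (ℚP.*-distribˡ-+ c (G m) (H m)) (pair-+ G H p) ⟩
    (c * G m + c * H m) + (pair G p + pair H p) ≡⟨ interchange (c * G m) _ _ _ ⟩
    (c * G m + pair G p) + (c * H m + pair H p) ∎
    where
    open ≡-Reasoning
    open CommutativeSemigroupProperties (CommutativeMonoid.commutativeSemigroup ℚP.+-0-commutativeMonoid)

  pair-onlyIf : ∀ {ℓ} {A : Set ℓ} (d : Dec A) H p → pair (λ m → onlyIf d (H m)) p ≡ onlyIf d (pair H p)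
  pair-onlyIf (yes _) H p = refl
  pair-onlyIf (no _)  H p = pair-zero p

  pair-hom : ∀ G j p → pair G (hom j p) ≡ pair (λ m → onlyIf (deg m ≟ j) (G m)) p
  pair-hom G j p = trans (sumOver-filter _ _ p)
    (sumOver-cong (λ (c , m) → onlyIf-*ʳ (deg m ≟ j) c (G m)) p)

  pair-mulP : ∀ G p q → pair G (mulP p q) ≡ pair (λ m → pair (λ m′ → G (m ⊕ m′)) q) p
  pair-mulP G []            q = refl
  pair-mulP G ((c , m) ∷ p) q = begin
    pair G (map _ q ++ mulP p q)                             ≡⟨ pair-++ G (map _ q) (mulP p q) ⟩
    pair G (map _ q) + pair G (mulP p q)                     ≡⟨ cong₂ _+_ (sumOver-map _ _ q) (pair-mulP G p q) ⟩
    sumOver (λ (d , m′) → c * d * G (m ⊕ m′)) q + _          ≡⟨ cong (_+ _) (sumOver-cong (λ (d , m′) → ℚP.*-assoc c d _) q) ⟩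
    sumOver (λ (d , m′) → c * (d * G (m ⊕ m′))) q + _        ≡⟨ cong (_+ _) (sumOver-*ˡ c _ q) ⟩
    c * pair (λ m′ → G (m ⊕ m′)) q + _                       ∎
    where open ≡-Reasoning

  projWeight : Fin a → Bool → (Mono n a → ℚ) → Mono n a → ℚ
  projWeight i false G (x , z) = onlyIf (lookup z i ≟ 0) (G (x , z))
  projWeight i true  G (x , z) = G (x , z [ i ]≔ 0)

  pair-projP : ∀ G i b p → pair G (projP i b p) ≡ pair (projWeight i b G) p
  pair-projP G i false p = trans (sumOver-filter _ _ p)
    (sumOver-cong (λ (c , (x , z)) → onlyIf-*ʳ (lookup z i ≟ 0) c _) p)
  pair-projP G i true  p = sumOver-map _ _ p

  indicator : Mono n a → Mono n a → ℚ
  indicator m m′ = onlyIf (monoEq? m′ m) 1ℚ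

  coeff-pair : ∀ p m → coeff p m ≡ pair (indicator m) p
  coeff-pair []             m = refl
  coeff-pair ((c , m′) ∷ p) m with monoEq? m′ m
  ... | yes _ = cong₂ _+_ (sym (ℚP.*-identityʳ c)) (coeff-pair p m)
  ... | no  _ = trans (coeff-pair p m)
                  (sym (trans (cong (_+ _) (ℚP.*-zeroʳ c)) (ℚP.+-identityˡ _)))

  coeff-hom : ∀ j p m → coeff (hom j p) m ≡ onlyIf (deg m ≟ j) (coeff p m)
  coeff-hom j p m = begin
    coeff (hom j p) m                                         ≡⟨ coeff-pair (hom j p) m ⟩
    pair (indicator m) (hom j p)                              ≡⟨ pair-hom _ j p ⟩
    pair (λ m′ → onlyIf (deg m′ ≟ j) (indicator m m′)) p      ≡⟨ pair-cong degree-of-support p ⟩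
    pair (λ m′ → onlyIf (deg m ≟ j) (indicator m m′)) p       ≡⟨ pair-onlyIf (deg m ≟ j) _ p ⟩
    onlyIf (deg m ≟ j) (pair (indicator m) p)                 ≡⟨ cong (onlyIf (deg m ≟ j)) (coeff-pair p m) ⟨
    onlyIf (deg m ≟ j) (coeff p m)                            ∎
    where
    open ≡-Reasoning
    degree-of-support : ∀ m′ → onlyIf (deg m′ ≟ j) (indicator m m′) ≡ onlyIf (deg m ≟ j) (indicator m m′)
    degree-of-support m′ with monoEq? m′ m
    ... | yes refl = refl
    ... | no  _    = trans (onlyIf-0ℚ (deg m′ ≟ j)) (sym (onlyIf-0ℚ (deg m ≟ j)))

  -- Equality of formal sums as polynomials

  infix 4 _≃_
  record _≃_ (p q : Poly n a) : Set where
    constructor pair-≡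
    field ≃⇒pair-≡ : ∀ G → pair G p ≡ pair G q
  open _≃_

  ≃-reflexive : ∀ {p q} → p ≡ q → p ≃ q
  ≃-reflexive refl = pair-≡ λ _ → refl

  ≃-refl : ∀ {p} → p ≃ p
  ≃-refl = ≃-reflexive refl

  ≃-sym : ∀ {p q} → p ≃ q → q ≃ p
  ≃-sym p≃q = pair-≡ λ G → sym (≃⇒pair-≡ p≃q G)

  ≃-trans : ∀ {p q r} → p ≃ q → q ≃ r → p ≃ r
  ≃-trans p≃q q≃r = pair-≡ λ G → trans (≃⇒pair-≡ p≃q G) (≃⇒pair-≡ q≃r G)

  ≃⇒coeff-≡ : ∀ {p q} → p ≃ q → ∀ m → coeff p m ≡ coeff q m
  ≃⇒coeff-≡ {p} {q} p≃q m =
    trans (coeff-pair p m) (trans (≃⇒pair-≡ p≃q _) (sym (coeff-pair q m)))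

  addP-cong : ∀ {p p′ q q′} → p ≃ p′ → q ≃ q′ → addP p q ≃ addP p′ q′
  addP-cong {p} {p′} {q} {q′} p≃p′ q≃q′ = pair-≡ λ G →
    trans (pair-++ G p q) (trans (cong₂ _+_ (≃⇒pair-≡ p≃p′ G) (≃⇒pair-≡ q≃q′ G)) (sym (pair-++ G p′ q′)))

  mulP-cong : ∀ {p p′ q q′} → p ≃ p′ → q ≃ q′ → mulP p q ≃ mulP p′ q′
  mulP-cong {p} {p′} {q} {q′} p≃p′ q≃q′ = pair-≡ λ G → begin
    pair G (mulP p q)                              ≡⟨ pair-mulP G p q ⟩
    pair (λ m → pair (λ m′ → G (m ⊕ m′)) q) p      ≡⟨ pair-cong (λ m → ≃⇒pair-≡ q≃q′ _) p ⟩
    pair (λ m → pair (λ m′ → G (m ⊕ m′)) q′) p     ≡⟨ ≃⇒pair-≡ p≃p′ _ ⟩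
    pair (λ m → pair (λ m′ → G (m ⊕ m′)) q′) p′    ≡⟨ pair-mulP G p′ q′ ⟨
    pair G (mulP p′ q′)                            ∎
    where open ≡-Reasoning

  projP-cong : ∀ i b {p p′} → p ≃ p′ → projP i b p ≃ projP i b p′
  projP-cong i b {p} {p′} p≃p′ = pair-≡ λ G →
    trans (pair-projP G i b p) (trans (≃⇒pair-≡ p≃p′ _) (sym (pair-projP G i b p′)))

  constP-0ℚ : constP 0ℚ ≃ []
  constP-0ℚ = pair-≡ λ G → trans (cong (_+ 0ℚ) (ℚP.*-zeroˡ (G (replicate n 0 , replicate a 0)))) (ℚP.+-identityˡ 0ℚ)

  NoAux-≃ : ∀ {p q} → p ≃ q → NoAux q → NoAux p
  NoAux-≃ p≃q noAux x z coeff≢0 = noAux x z (λ coeff≡0 → coeff≢0 (trans (≃⇒coeff-≡ p≃q (x , z)) coeff≡0))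

  NoAux-hom : ∀ j {p} → NoAux p → NoAux (hom j p)
  NoAux-hom j {p} noAux x z coeff≢0 = noAux x z λ coeff≡0 →
    coeff≢0 (trans (coeff-hom j p (x , z)) (trans (cong (onlyIf (∣ x ∣ ≟ j)) coeff≡0) (onlyIf-0ℚ (∣ x ∣ ≟ j))))

  hom-addP : ∀ j (p q : Poly n a) → hom j (addP p q) ≡ addP (hom j p) (hom j q)
  hom-addP j = ListP.filter-++ _

  hom-projP : ∀ j i b (p : Poly n a) → hom j (projP i b p) ≡ projP i b (hom j p)
  hom-projP j i false p = filter-comm _ _ p
  hom-projP j i true  [] = refl
  hom-projP j i true  ((c , (x , z)) ∷ p) with does (∣ x ∣ ≟ j)
  ... | true  = cong (_ ∷_) (hom-projP j i true p)
  ... | false = hom-projP j i true p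

  partialProduct : Poly n a → Poly n a → ℕ → ℕ → Poly n a
  partialProduct p q j zero    = mulP (hom 0 p) (hom j q)
  partialProduct p q j (suc i) =
    addP (partialProduct p q j i) (mulP (hom (suc i) p) (hom (j ∸ suc i) q))

  module _ (G : Mono n a → ℚ) (p q : Poly n a) (j : ℕ) where

    private
      shiftedPairing : ℕ → Mono n a → ℚ
      shiftedPairing i m = pair (λ m′ → onlyIf (deg m′ ≟ j ∸ i) (G (m ⊕ m′))) q

      pair-homProduct : ∀ i →
        pair G (mulP (hom i p) (hom (j ∸ i) q)) ≡ pair (λ m → onlyIf (deg m ≟ i) (shiftedPairing i m)) p
      pair-homProduct i = trans (pair-mulP G (hom i p) _) (trans (pair-hom _ i p)
        (pair-cong (λ m → cong (onlyIf (deg m ≟ i)) (pair-hom _ (j ∸ i) q)) p))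

      pair-partialProduct : ∀ i →
        pair G (partialProduct p q j i) ≡ pair (λ m → onlyIf (deg m ≤? i) (shiftedPairing (deg m) m)) p
      pair-partialProduct zero =
        trans (pair-homProduct 0) (pair-cong (λ m → onlyIf-≤?-zero (deg m) (λ i → shiftedPairing i m)) p)
      pair-partialProduct (suc i) = begin
        pair G (partialProduct p q j (suc i))
          ≡⟨ pair-++ G (partialProduct p q j i) _ ⟩
        pair G (partialProduct p q j i) + pair G (mulP (hom (suc i) p) (hom (j ∸ suc i) q))
          ≡⟨ cong₂ _+_ (pair-partialProduct i) (pair-homProduct (suc i)) ⟩
        pair (λ m → onlyIf (deg m ≤? i) (shiftedPairing (deg m) m)) p
          + pair (λ m → onlyIf (deg m ≟ suc i) (shiftedPairing (suc i) m)) p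
          ≡⟨ pair-+ _ _ p ⟨
        pair (λ m → onlyIf (deg m ≤? i) (shiftedPairing (deg m) m)
                    + onlyIf (deg m ≟ suc i) (shiftedPairing (suc i) m)) p
          ≡⟨ pair-cong (λ m → onlyIf-≤?-suc (deg m) i (λ i → shiftedPairing i m)) p ⟩
        pair (λ m → onlyIf (deg m ≤? suc i) (shiftedPairing (deg m) m)) p
          ∎
        where open ≡-Reasoning

      shiftedPairing-deg : ∀ m → onlyIf (deg m ≤? j) (shiftedPairing (deg m) m)
                                 ≡ pair (λ m′ → onlyIf (deg (m ⊕ m′) ≟ j) (G (m ⊕ m′))) q
      shiftedPairing-deg m with deg m ≤? j
      ... | yes deg≤j = pair-cong (λ m′ → onlyIf-⇔ (deg m′ ≟ j ∸ deg m) (deg (m ⊕ m′) ≟ j)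
              (λ e → trans (deg-⊕ m m′) (trans (cong (deg m ℕ.+_) e) (NP.m+[n∸m]≡n deg≤j)))
              (λ e → trans (sym (NP.m+n∸m≡n (deg m) (deg m′))) (cong (_∸ deg m) (trans (sym (deg-⊕ m m′)) e)))
              _) q
      ... | no  deg≰j = sym (trans (pair-cong (λ m′ → onlyIf-no (deg (m ⊕ m′) ≟ j)
              (λ e → deg≰j (subst (deg m ≤_) (trans (sym (deg-⊕ m m′)) e) (NP.m≤m+n (deg m) (deg m′)))) _) q)
              (pair-zero q))

    pair-hom-mulP : pair G (hom j (mulP p q)) ≡ pair G (partialProduct p q j j)
    pair-hom-mulP = begin
      pair G (hom j (mulP p q))                                              ≡⟨ pair-hom G j (mulP p q) ⟩
      pair (λ m → onlyIf (deg m ≟ j) (G m)) (mulP p q)                       ≡⟨ pair-mulP _ p q ⟩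
      pair (λ m → pair (λ m′ → onlyIf (deg (m ⊕ m′) ≟ j) (G (m ⊕ m′))) q) p   ≡⟨ pair-cong shiftedPairing-deg p ⟨
      pair (λ m → onlyIf (deg m ≤? j) (shiftedPairing (deg m) m)) p          ≡⟨ pair-partialProduct j ⟨
      pair G (partialProduct p q j j)                                        ∎
      where open ≡-Reasoning

  hom-mulP : ∀ j p q → hom j (mulP p q) ≃ partialProduct p q j j
  hom-mulP j p q = pair-≡ λ G → pair-hom-mulP G p q j

-- Growing straight-line programs

lookup-∷ʳ-inject₁ : ∀ {A : Set} {m} (xs : Vec A m) y i → lookup (xs ∷ʳ y) (inject₁ i) ≡ lookup xs i
lookup-∷ʳ-inject₁ (x ∷ xs) y Fin.zero    = refl
lookup-∷ʳ-inject₁ (x ∷ xs) y (Fin.suc i) = lookup-∷ʳ-inject₁ xs y i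

lookup-∷ʳ-fromℕ : ∀ {A : Set} {m} (xs : Vec A m) y → lookup (xs ∷ʳ y) (fromℕ m) ≡ y
lookup-∷ʳ-fromℕ []       y = refl
lookup-∷ʳ-fromℕ (x ∷ xs) y = lookup-∷ʳ-fromℕ xs y

module _ {n a : ℕ} where

  gateValue : ∀ {i} → Vec (Poly n a) i → Gate n a i → Poly n a
  gateValue vs (xLeaf j)    = varX j
  gateValue vs (zLeaf j)    = varZ j
  gateValue vs (cLeaf c _)  = constP c
  gateValue vs (add j k)    = addP (lookup vs j) (lookup vs k)
  gateValue vs (mul j k)    = mulP (lookup vs j) (lookup vs k)
  gateValue vs (proj z b j) = projP z b (lookup vs j)

  evalAll-▷ : ∀ {i} (Φ : Circuit n a i) g → evalAll (Φ ▷ g) ≡ evalAll Φ ∷ʳ gateValue (evalAll Φ) g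
  evalAll-▷ Φ (xLeaf _)    = refl
  evalAll-▷ Φ (zLeaf _)    = refl
  evalAll-▷ Φ (cLeaf _ _)  = refl
  evalAll-▷ Φ (add _ _)    = refl
  evalAll-▷ Φ (mul _ _)    = refl
  evalAll-▷ Φ (proj _ _ _) = refl

  output-▷ : ∀ {i} (Φ : Circuit n a i) g → output (Φ ▷ g) ≡ gateValue (evalAll Φ) g
  output-▷ Φ g = trans (cong Data.Vec.last (evalAll-▷ Φ g)) (VecP.last-∷ʳ _ (evalAll Φ))

  output≡lookup-fromℕ : ∀ {s} (Φ : Circuit n a (suc s)) → output Φ ≡ lookup (evalAll Φ) (fromℕ s)
  output≡lookup-fromℕ (Φ ▷ g) = trans (output-▷ Φ g)
    (sym (trans (cong (λ vs → lookup vs _) (evalAll-▷ Φ g)) (lookup-∷ʳ-fromℕ (evalAll Φ) _)))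

  record Program : Set where
    constructor program
    field
      {size}  : ℕ
      circuit : Circuit n a size
  open Program

  value : (P : Program) → Fin (size P) → Poly n a
  value P = lookup (evalAll (circuit P))

  _▷⁺_ : (P : Program) → Gate n a (size P) → Program
  P ▷⁺ g = program (circuit P ▷ g)

  value-▷⁺-inject₁ : ∀ P g i → value (P ▷⁺ g) (inject₁ i) ≡ value P i
  value-▷⁺-inject₁ P g i = trans (cong (λ vs → lookup vs (inject₁ i)) (evalAll-▷ (circuit P) g))
    (lookup-∷ʳ-inject₁ (evalAll (circuit P)) _ i)

  value-▷⁺-fromℕ : ∀ P g → value (P ▷⁺ g) (fromℕ (size P)) ≡ gateValue (evalAll (circuit P)) g
  value-▷⁺-fromℕ P g = trans (cong (λ vs → lookup vs (fromℕ _)) (evalAll-▷ (circuit P) g))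
    (lookup-∷ʳ-fromℕ (evalAll (circuit P)) _)

  infix 4 _⊑_
  record _⊑_ (P Q : Program) : Set where
    field
      embed       : Fin (size P) → Fin (size Q)
      value-embed : ∀ i → value Q (embed i) ≡ value P i
  open _⊑_

  ⊑-refl : ∀ {P} → P ⊑ P
  ⊑-refl = record { embed = λ i → i ; value-embed = λ _ → refl }

  ⊑-trans : ∀ {P Q R} → P ⊑ Q → Q ⊑ R → P ⊑ R
  ⊑-trans P⊑Q Q⊑R = record
    { embed       = λ i → embed Q⊑R (embed P⊑Q i)
    ; value-embed = λ i → trans (value-embed Q⊑R _) (value-embed P⊑Q i)
    }

  ⊑-▷⁺ : ∀ P g → P ⊑ P ▷⁺ g
  ⊑-▷⁺ P g = record { embed = inject₁ ; value-embed = value-▷⁺-inject₁ P g }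

  record Extension (P : Program) (c : ℕ) (Goal : Program → Set) : Set where
    field
      {extended} : Program
      extends    : P ⊑ extended
      achieves   : Goal extended
      within     : size extended ≤ size P ℕ.+ c

  done : ∀ {P Goal} → Goal P → Extension P 0 Goal
  done {P} goal = record { extends = ⊑-refl ; achieves = goal ; within = NP.≤-reflexive (sym (NP.+-identityʳ (size P))) }

  Extension-≤ : ∀ {P c c′ Goal} → c ≤ c′ → Extension P c Goal → Extension P c′ Goal
  Extension-≤ {P} c≤c′ e = record
    { extends = extends ; achieves = achieves ; within = NP.≤-trans within (NP.+-monoʳ-≤ (size P) c≤c′) }
    where open Extension e

  Extension-map : ∀ {P c G H} → (∀ {Q} → P ⊑ Q → G Q → H Q) → Extension P c G → Extension P c H
  Extension-map f e = record { extends = extends ; achieves = f extends achieves ; within = within }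
    where open Extension e

  bind : ∀ {P c c′ G H} → Extension P c G → (∀ {Q} → P ⊑ Q → G Q → Extension Q c′ H) → Extension P (c ℕ.+ c′) H
  bind {P} {c} {c′} e k = record
    { extends  = ⊑-trans (extends e) (extends e′)
    ; achieves = achieves e′
    ; within   = NP.≤-trans (within e′) (NP.≤-trans (NP.+-monoˡ-≤ c′ (within e)) (NP.≤-reflexive (NP.+-assoc (size P) c c′)))
    }
    where
    open Extension
    e′ = k (extends e) (achieves e)

  record Computes (f : Poly n a) (Q : Program) : Set where
    constructor computedBy
    field
      gate       : Fin (size Q)
      value-gate : value Q gate ≃ f

  Computes-⊑ : ∀ {f P Q} → P ⊑ Q → Computes f P → Computes f Q
  Computes-⊑ P⊑Q (computedBy r r≃f) = computedBy (embed P⊑Q r) (≃-trans (≃-reflexive (value-embed P⊑Q r)) r≃f)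

  Computes-≃ : ∀ {f f′ Q} → f ≃ f′ → Computes f Q → Computes f′ Q
  Computes-≃ f≃f′ (computedBy r r≃f) = computedBy r (≃-trans r≃f f≃f′)

  extend₁ : ∀ {f} (P : Program) (g : Gate n a (size P)) → gateValue (evalAll (circuit P)) g ≃ f → Extension P 1 (Computes f)
  extend₁ P g g≃f = record
    { extends  = ⊑-▷⁺ P g
    ; achieves = computedBy (fromℕ (size P)) (≃-trans (≃-reflexive (value-▷⁺-fromℕ P g)) g≃f)
    ; within   = NP.≤-reflexive (NP.+-comm 1 (size P))
    }

  -- Quantifying over extensions of P lets a builder run after other gates have been added.
  Buildable : ℕ → Poly n a → Program → Set
  Buildable c f P = ∀ {Q} → P ⊑ Q → Extension Q c (Computes f)

  Buildable-≤ : ∀ {c c′ f P} → c ≤ c′ → Buildable c f P → Buildable c′ f P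
  Buildable-≤ c≤c′ build P⊑Q = Extension-≤ c≤c′ (build P⊑Q)

  record HomTable (m : ℕ) (f : Poly n a) (P : Program) : Set where
    constructor homTable
    field component : ∀ j → j < m → Computes (hom j f) P
  open HomTable

  HomTable-⊑ : ∀ {m f P Q} → P ⊑ Q → HomTable m f P → HomTable m f Q
  HomTable-⊑ P⊑Q T = homTable λ j j<m → Computes-⊑ P⊑Q (component T j j<m)

  HomTable-snoc : ∀ {m f P} → HomTable m f P → Computes (hom m f) P → HomTable (suc m) f P
  HomTable-snoc {m} {f} {P} T r = homTable λ j j<1+m → entry j j<1+m (j ≟ m)
    where
    entry : ∀ j → j < suc m → Dec (j ≡ m) → Computes (hom j f) P
    entry j _     (yes refl) = r
    entry j j<1+m (no j≢m)   = component T j (NP.≤∧≢⇒< (s≤s⁻¹ j<1+m) j≢m)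

  tabulate : ∀ {c f P} m → (∀ j → j < m → Buildable c (hom j f) P) → Extension P (m ℕ.* c) (HomTable m f)
  tabulate zero    build = done (homTable λ _ ())
  tabulate {c} (suc m) build = Extension-≤ (NP.≤-reflexive (NP.+-comm (m ℕ.* c) c)) $
    bind (tabulate m (λ j j<m → build j (NP.m<n⇒m<1+n j<m))) λ P⊑Q T →
      Extension-map (λ Q⊑R r → HomTable-snoc (HomTable-⊑ Q⊑R T) r) (build m (NP.n<1+n m) P⊑Q)

  -- Homogeneous components gate by gate

  buildHomTerm : ∀ (g : ∀ {i} → Gate n a i) {t} → (∀ {i} (vs : Vec (Poly n a) i) → gateValue vs g ≡ t ∷ []) →
                 ∀ j {P} → Buildable 1 (hom j (t ∷ [])) P
  buildHomTerm g {c , (x , z)} value-g j {Q = Q} _ with does (∣ x ∣ ≟ j)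
  ... | true  = extend₁ Q g (≃-reflexive (value-g _))
  ... | false = extend₁ Q (cLeaf 0ℚ ℚP.≤-refl) constP-0ℚ

  module _ (k : ℕ) {U V : Poly n a} {P : Program} (TU : HomTable (suc k) U P) (TV : HomTable (suc k) V P)
           {j : ℕ} (j<1+k : j < suc k) where

    buildHomProduct : ∀ i → i ≤ j → Buildable 1 (mulP (hom i U) (hom (j ∸ i) V)) P
    buildHomProduct i i≤j {Q} P⊑Q =
      extend₁ Q (mul (gate u) (gate v)) (mulP-cong (value-gate u) (value-gate v))
      where
      open Computes
      u = Computes-⊑ P⊑Q (component TU i (NP.≤-<-trans i≤j j<1+k))
      v = Computes-⊑ P⊑Q (component TV (j ∸ i) (NP.≤-<-trans (NP.m∸n≤m j i) j<1+k))

    buildPartialProduct : ∀ i → i ≤ j → Buildable (suc (2 ℕ.* i)) (partialProduct U V j i) P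
    buildPartialProduct zero    _   P⊑Q = buildHomProduct 0 z≤n P⊑Q
    buildPartialProduct (suc i) i<j P⊑Q = Extension-≤ (NP.≤-reflexive (cost i)) $
      bind (buildPartialProduct i (NP.<⇒≤ i<j) P⊑Q) λ Q⊑R s →
      bind (buildHomProduct (suc i) i<j (⊑-trans P⊑Q Q⊑R)) λ {S} R⊑S t →
      let s′ = Computes-⊑ R⊑S s in
      extend₁ S (add (gate s′) (gate t)) (addP-cong (value-gate s′) (value-gate t))
      where
      open Computes
      cost : ∀ i → suc (2 ℕ.* i) ℕ.+ (1 ℕ.+ 1) ≡ suc (2 ℕ.* suc i)
      cost = solve-∀

    buildHomMulP : Buildable (2 ℕ.* suc k) (hom j (mulP U V)) P
    buildHomMulP P⊑Q = Extension-≤ cost≤ $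
      Extension-map (λ _ → Computes-≃ (≃-sym (hom-mulP j U V))) (buildPartialProduct j NP.≤-refl P⊑Q)
      where
      double-suc : ∀ j → 2 ℕ.* suc j ≡ suc (suc (2 ℕ.* j))
      double-suc = solve-∀
      cost≤ : suc (2 ℕ.* j) ≤ 2 ℕ.* suc k
      cost≤ = NP.≤-trans (NP.n≤1+n _) (NP.≤-trans (NP.≤-reflexive (sym (double-suc j))) (NP.*-monoʳ-≤ 2 j<1+k))

  buildHomGate : ∀ k {i} {vs : Vec (Poly n a) i} {P} → (∀ u → HomTable (suc k) (lookup vs u) P) →
                 (g : Gate n a i) → ∀ j → j < suc k → Buildable (2 ℕ.* suc k) (hom j (gateValue vs g)) P
  buildHomGate k T (xLeaf i)    j _ = Buildable-≤ (s≤s z≤n) (buildHomTerm (xLeaf i) (λ _ → refl) j)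
  buildHomGate k T (zLeaf i)    j _ = Buildable-≤ (s≤s z≤n) (buildHomTerm (zLeaf i) (λ _ → refl) j)
  buildHomGate k T (cLeaf c 0≤c) j _ = Buildable-≤ (s≤s z≤n) (buildHomTerm (cLeaf c 0≤c) (λ _ → refl) j)
  buildHomGate k {vs = vs} T (add u v) j j<1+k {Q} P⊑Q = Extension-≤ (s≤s z≤n) $
    extend₁ Q (add (gate ru) (gate rv))
      (≃-trans (addP-cong (value-gate ru) (value-gate rv)) (≃-reflexive (sym (hom-addP j (lookup vs u) (lookup vs v)))))
    where
    open Computes
    ru = Computes-⊑ P⊑Q (component (T u) j j<1+k)
    rv = Computes-⊑ P⊑Q (component (T v) j j<1+k)
  buildHomGate k T (mul u v)    j j<1+k = buildHomMulP k (T u) (T v) j<1+k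
  buildHomGate k {vs = vs} T (proj z b u) j j<1+k {Q} P⊑Q = Extension-≤ (s≤s z≤n) $
    extend₁ Q (proj z b (gate ru))
      (≃-trans (projP-cong z b (value-gate ru)) (≃-reflexive (sym (hom-projP j z b (lookup vs u)))))
    where
    open Computes
    ru = Computes-⊑ P⊑Q (component (T u) j j<1+k)

  HomTables : ℕ → ∀ {i} → Circuit n a i → Program → Set
  HomTables k Φ P = ∀ u → HomTable (suc k) (lookup (evalAll Φ) u) P

  HomTables-▷ : ∀ k {i} {Φ : Circuit n a i} {g P} → HomTables k Φ P →
                HomTable (suc k) (gateValue (evalAll Φ) g) P → HomTables k (Φ ▷ g) P
  HomTables-▷ k {Φ = Φ} {g} {P} T T′ u rewrite evalAll-▷ Φ g with view u
  ... | ‵fromℕ      = subst (λ f → HomTable (suc k) f P) (sym (lookup-∷ʳ-fromℕ (evalAll Φ) _)) T′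
  ... | ‵inject₁ u′ = subst (λ f → HomTable (suc k) f P) (sym (lookup-∷ʳ-inject₁ (evalAll Φ) _ u′)) (T u′)

  homogenise : ∀ k {i} (Φ : Circuit n a i) → Extension (program []) (i ℕ.* (suc k ℕ.* (2 ℕ.* suc k))) (HomTables k Φ)
  homogenise k []      = done (λ ())
  homogenise k {suc i} (Φ ▷ g) = Extension-≤ (NP.≤-reflexive (NP.+-comm (i ℕ.* _) _)) $
    bind (homogenise k Φ) λ _ T →
      Extension-map (λ Q⊑R T′ → HomTables-▷ k {Φ = Φ} {g} (λ u → HomTable-⊑ Q⊑R (T u)) T′)
        (tabulate {f = gateValue (evalAll Φ) g} (suc k) (buildHomGate k T g))

  withOutput : (P : Program) → Fin (size P) → Circuit n a (suc (suc (size P)))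
  withOutput P r = (circuit P ▷ cLeaf 0ℚ ℚP.≤-refl) ▷ add (inject₁ r) (fromℕ (size P))

  output-withOutput : ∀ P r → output (withOutput P r) ≃ value P r
  output-withOutput P r = ≃-trans (≃-reflexive (trans (output-▷ (circuit P ▷ zeroLeaf) (add (inject₁ r) (fromℕ (size P)))) (cong₂ addP
      (value-▷⁺-inject₁ P zeroLeaf r) (value-▷⁺-fromℕ P zeroLeaf))))
    (≃-trans (addP-cong ≃-refl constP-0ℚ) (≃-reflexive (ListP.++-identityʳ (value P r))))
    where
    zeroLeaf : Gate n a (size P)
    zeroLeaf = cLeaf 0ℚ ℚP.≤-refl

size-bound : ∀ k s {x} → x ≤ 0 ℕ.+ suc s ℕ.* (suc k ℕ.* (2 ℕ.* suc k)) →
             suc (suc x) ≤ 4 ℕ.* (suc k ℕ.* suc k) ℕ.* suc s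
size-bound k s {x} x≤ = begin
  suc (suc x)                                                ≤⟨ s≤s (s≤s x≤) ⟩
  suc (suc (0 ℕ.+ suc s ℕ.* (suc k ℕ.* (2 ℕ.* suc k))))      ≡⟨ expand k s ⟩
  2 ℕ.* 1 ℕ.+ 2 ℕ.* Y                                         ≤⟨ NP.+-monoˡ-≤ (2 ℕ.* Y) (NP.*-monoʳ-≤ 2 (s≤s z≤n)) ⟩
  2 ℕ.* Y ℕ.+ 2 ℕ.* Y                                         ≡⟨ collect k s ⟩
  4 ℕ.* (suc k ℕ.* suc k) ℕ.* suc s                          ∎
  where
  open NP.≤-Reasoning
  Y = suc k ℕ.* suc k ℕ.* suc s
  expand : ∀ k s → suc (suc (0 ℕ.+ suc s ℕ.* (suc k ℕ.* (2 ℕ.* suc k)))) ≡ 2 ℕ.* 1 ℕ.+ 2 ℕ.* (suc k ℕ.* suc k ℕ.* suc s)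
  expand = solve-∀
  collect : ∀ k s → 2 ℕ.* (suc k ℕ.* suc k ℕ.* suc s) ℕ.+ 2 ℕ.* (suc k ℕ.* suc k ℕ.* suc s) ≡ 4 ℕ.* (suc k ℕ.* suc k) ℕ.* suc s
  collect = solve-∀

mainTheorem8 : ∃[ C ] (∀ {n a s} (Φ : Circuit n a (suc s)) → NoAux (output Φ) →
                 ∀ k → ≤deg k (output Φ) →
                 ∃[ a' ] ∃[ s' ] Σ (Circuit n a' (suc s')) λ Ψ →
                   NoAux (output Ψ) × (output Ψ ≈ₓ hom k (output Φ)) ×
                   suc s' ≤ C ℕ.* (suc k ℕ.* suc k) ℕ.* suc s)
mainTheorem8 = 4 , λ {n} {a} {s} Φ noAux k _ →
  let open Extension (homogenise k Φ)
      open Computes (HomTable.component (achieves (fromℕ s)) k (NP.n<1+n k))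
      Ψ≃hom : output (withOutput extended gate) ≃ hom k (output Φ)
      Ψ≃hom = ≃-trans (output-withOutput extended gate)
                (≃-trans value-gate (≃-reflexive (cong (hom k) (sym (output≡lookup-fromℕ Φ)))))
  in a , suc (Program.size extended) , withOutput extended gate ,
     NoAux-≃ Ψ≃hom (NoAux-hom k {output Φ} noAux) ,
     (λ x → ≃⇒coeff-≡ Ψ≃hom (x , replicate a 0)) ,
     size-bound k s within
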